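{- Let $n$ be an odd prime, let $\overrightarrow{a}$ be the staircase array and $v_0\in\mathbb{Z}_n\times\mathbb{Z}_n$, and let $G=\langle c\rangle$ with $c(a,b)=(a+1,b)$. Then the path $P=P(v_0,\overrightarrow{a})$ in $K_n\Box K_n$ contains at most one edge from each orbit of $G$ on $E(K_n\Box K_n)$.
   Context: $K_n \Box K_n$ has vertex set $\mathbb{Z}_n\times\mathbb{Z}_n$, with $(a,b)$ and $(c,d)$ adjacent iff they are distinct and $a=c$ or $b=d$; $c$ is an automorphism and $G$ has order $n$. For an array $\overrightarrow{a}=[a_1,\dots,a_\ell]$, $P(v_0,\overrightarrow{a})$ is the walk $v_0v_1\cdots v_\ell$ with $v_i=v_0+\sum_{g=1}^i a_g$ and edges $\{v_{i-1},v_i\}$ (for the staircase array this walk is a path). For odd $n$, the staircase array is the concatenation of the stretches $S_1,\dots,S_{(n-1)/2}$, where $S_k$ has length $2n$ and its $g$-th entry is $(0,2k-1)$ for odd $g$, $(2k-1,0)$ for even $g<2n$, and $(2k,0)$ for $g=2n$. -}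

module Defs where

open import Data.Nat using (ℕ; zero; suc; _+_; _*_; _∸_; _/_; _%_; _≡ᵇ_)
open import Data.Nat.Properties using ()
open import Data.Bool using (Bool; true; false; if_then_else_)
open import Data.Fin using (Fin; toℕ)
open import Data.List using (List; []; _∷_; map; concatMap; applyUpTo; take; length)
open import Data.Nat.ListAction using (sum)
open import Data.Product using (_×_; _,_; proj₁; proj₂; ∃)
open import Data.Sum using (_⊎_)
open import Relation.Binary.PropositionalEquality using (_≡_)

-- Reduction modulo n (elements of ℤ_n represented by 0..n-1).
-- (The n = 0 case is never used: n is an odd prime.)
modN : ℕ → ℕ → ℕ
modN zero    x = x
modN (suc m) x = x % suc m

-- Vertices of K_n □ K_n: pairs of residues mod n; steps of an array: pairs of naturals.
Vertex : Set
Vertex = ℕ × ℕ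

-- g-th entry (g = 1..2n) of the stretch S_k.
stretchEntry : ℕ → ℕ → ℕ → ℕ × ℕ
stretchEntry n k g =
  if g % 2 ≡ᵇ 1 then (0 , 2 * k ∸ 1)
  else (if g ≡ᵇ 2 * n then (2 * k , 0) else (2 * k ∸ 1 , 0))

stretch : ℕ → ℕ → List (ℕ × ℕ)
stretch n k = map (stretchEntry n k) (applyUpTo suc (2 * n))

staircase : ℕ → List (ℕ × ℕ)
staircase n = concatMap (stretch n) (applyUpTo suc ((n ∸ 1) / 2))

walkVertex : (n : ℕ) → Fin n × Fin n → List (ℕ × ℕ) → ℕ → Vertex
walkVertex n (x , y) a i =
  ( modN n (toℕ x + sum (map proj₁ (take i a)))
  , modN n (toℕ y + sum (map proj₂ (take i a))) )

-- Edge {v_i, v_{i+1}} of P(v_0, a), for i = 0 .. ℓ-1 (the paper's (i+1)-th edge).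
walkEdge : (n : ℕ) → Fin n × Fin n → List (ℕ × ℕ) → ℕ → Vertex × Vertex
walkEdge n v0 a i = (walkVertex n v0 a i , walkVertex n v0 a (suc i))

cPow : ℕ → ℕ → Vertex → Vertex
cPow n t (a , b) = (modN n (a + t) , b)

SameEdge : Vertex × Vertex → Vertex × Vertex → Set
SameEdge (u , v) (u' , v') = (u ≡ u' × v ≡ v') ⊎ (u ≡ v' × v ≡ u')

SameOrbit : ℕ → Vertex × Vertex → Vertex × Vertex → Set
SameOrbit n (u , v) e' = ∃ λ t → SameEdge (cPow n t u , cPow n t v) e'

{-# OPTIONS --safe #-}
-- Modulo the shifts c^t, an edge of K_n □ K_n is determined by the heights (second coordinates) of its
-- endpoints and its horizontal displacement up to sign. In the stretch S_k the walk alternates vertical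
-- and horizontal steps of length 2k - 1 (the last horizontal one has length 2k), so at position r it sits
-- at height ⌈r/2⌉(2k - 1) mod n, and it is back at height 0 after each stretch. Two edges in one orbit
-- have equal or opposite vertical steps, and equal or opposite horizontal ones. All step lengths lie in
-- 1 .. n - 1 and a sum of two of the same parity is even and below 2n, so the steps are equal, which fixes
-- k; the one exception, a last step against an ordinary horizontal one, is excluded by the heights
-- (0 against a nonzero multiple of 2k - 1). The height a(2k - 1), a < n, then fixes the position, as n is
-- prime.
module Submission where

open import Defs
open import Data.Bool using (true; false; T)
open import Data.Bool.Properties using (T-≡)
open import Data.Empty using (⊥-elim)
open import Data.Fin using (Fin; toℕ)
open import Data.List using (List; []; _∷_; _++_; map; concatMap; applyUpTo; take; length)
open import Data.List.Properties using (length-++; length-map; length-applyUpTo)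
open import Function.Base using (_∘_)
open import Data.Nat hiding (parity)
open import Data.Nat.DivMod
open import Data.Nat.Divisibility using (_∣_; m%n≡0⇒n∣m; >⇒∤)
open import Data.Nat.ListAction using (sum)
open import Data.Nat.Primality using (Prime; euclidsLemma)
open import Data.Nat.Properties
open import Data.Nat.Tactic.RingSolver using (solve-∀)
open import Data.Product using (_×_; _,_; proj₁; proj₂)
open import Data.Sum using (_⊎_; inj₁; inj₂)
open import Function.Bundles using (Equivalence)
open import Level using (0ℓ)
open import Relation.Binary.Bundles using (Setoid)
import Relation.Binary.Reasoning.Setoid
open import Relation.Binary.Structures using (IsEquivalence)
open import Relation.Binary.PropositionalEquality
open import Relation.Nullary using (¬_; contradiction)

nth : {A : Set} → A → List A → ℕ → A
nth d []       _       = d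
nth d (x ∷ xs) zero    = x
nth d (x ∷ xs) (suc i) = nth d xs i

module _ {A : Set} (d : A) where

  sum-map-take-suc : (f : A → ℕ) (xs : List A) {i : ℕ} → i < length xs →
    sum (map f (take (suc i) xs)) ≡ sum (map f (take i xs)) + f (nth d xs i)
  sum-map-take-suc f (x ∷ xs) {zero}  _         = +-comm (f x) 0
  sum-map-take-suc f (x ∷ xs) {suc i} (s≤s i<) =
    trans (cong (f x +_) (sum-map-take-suc f xs i<)) (sym (+-assoc (f x) _ _))

  nth-++ˡ : (xs ys : List A) {i : ℕ} → i < length xs → nth d (xs ++ ys) i ≡ nth d xs i
  nth-++ˡ (x ∷ xs) ys {zero}  _        = refl
  nth-++ˡ (x ∷ xs) ys {suc i} (s≤s i<) = nth-++ˡ xs ys i<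

  nth-++ʳ : (xs ys : List A) (i : ℕ) → nth d (xs ++ ys) (length xs + i) ≡ nth d ys i
  nth-++ʳ []       ys i = refl
  nth-++ʳ (x ∷ xs) ys i = nth-++ʳ xs ys i

  nth-map-applyUpTo : {B : Set} (g : B → A) (f : ℕ → B) (m : ℕ) {r : ℕ} → r < m →
    nth d (map g (applyUpTo f m)) r ≡ g (f r)
  nth-map-applyUpTo g f (suc m) {zero}  _        = refl
  nth-map-applyUpTo g f (suc m) {suc r} (s≤s r<) = nth-map-applyUpTo g (f ∘ suc) m r<

module _ {A B : Set} {N : ℕ} (block : B → List A) (length-block : ∀ b → length (block b) ≡ N) where

  length-concatMap-applyUpTo : (f : ℕ → B) (m : ℕ) →
    length (concatMap block (applyUpTo f m)) ≡ m * N
  length-concatMap-applyUpTo f zero    = refl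
  length-concatMap-applyUpTo f (suc m) =
    trans (length-++ (block (f 0)))
          (cong₂ _+_ (length-block (f 0)) (length-concatMap-applyUpTo (f ∘ suc) m))

  nth-concatMap-applyUpTo : (d : A) (f : ℕ → B) {m q r : ℕ} → q < m → r < N →
    nth d (concatMap block (applyUpTo f m)) (q * N + r) ≡ nth d (block (f q)) r
  nth-concatMap-applyUpTo d f {suc m} {zero}      _        r<N =
    nth-++ˡ d (block (f 0)) _ (subst (_ <_) (sym (length-block (f 0))) r<N)
  nth-concatMap-applyUpTo d f {suc m} {suc q} {r} (s≤s q<m) r<N = begin
    nth d (first ++ rest) (N + q * N + r)               ≡⟨ cong (nth d (first ++ rest)) index ⟩
    nth d (first ++ rest) (length first + (q * N + r))  ≡⟨ nth-++ʳ d first rest (q * N + r) ⟩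
    nth d rest (q * N + r)                              ≡⟨ nth-concatMap-applyUpTo d (f ∘ suc) q<m r<N ⟩
    nth d (block (f (suc q))) r                         ∎
    where
    open ≡-Reasoning
    first = block (f 0)
    rest  = concatMap block (applyUpTo (f ∘ suc) m)
    index : N + q * N + r ≡ length first + (q * N + r)
    index = trans (+-assoc N (q * N) r) (cong (_+ (q * N + r)) (sym (length-block (f 0))))

2*≡ : ∀ m → 2 * m ≡ m + m
2*≡ m = cong (m +_) (+-identityʳ m)

2*suc≡ : ∀ m → 2 * suc m ≡ suc (suc (m + m))
2*suc≡ m = trans (2*≡ (suc m)) (cong suc (+-suc m m))

data Parity : ℕ → Set where
  even : ∀ m → Parity (m + m)
  odd  : ∀ m → Parity (suc (m + m))

parity : ∀ r → Parity r
parity zero = even 0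
parity (suc r) with parity r
... | even m = odd m
... | odd m  = subst Parity (cong suc (+-suc m m)) (even (suc m))

[1+m+m]%2≡1 : ∀ m → suc (m + m) % 2 ≡ 1
[1+m+m]%2≡1 m = trans (cong (λ k → suc k % 2) (trans (sym (2*≡ m)) (*-comm 2 m))) ([m+kn]%n≡m%n 1 m 2)

[2+m+m]%2≡0 : ∀ m → suc (suc (m + m)) % 2 ≡ 0
[2+m+m]%2≡0 m = trans (cong (_% 2) (trans (sym (2*suc≡ m)) (*-comm 2 (suc m)))) (m*n%n≡0 (suc m) 2)

≡⇒≡ᵇ≡true : ∀ {a b} → a ≡ b → (a ≡ᵇ b) ≡ true
≡⇒≡ᵇ≡true {a} {b} a≡b = Equivalence.to T-≡ (≡⇒≡ᵇ a b a≡b)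

≢⇒≡ᵇ≡false : ∀ {a b} → a ≢ b → (a ≡ᵇ b) ≡ false
≢⇒≡ᵇ≡false {a} {b} a≢b with a ≡ᵇ b in eq
... | true  = contradiction (≡ᵇ⇒≡ a b (subst T (sym eq) _)) a≢b
... | false = refl

module Modulo (n-1 : ℕ) where

  n : ℕ
  n = suc n-1

  infix 4 _≈_
  record _≈_ (a b : ℕ) : Set where
    constructor congruent
    field residues : a % n ≡ b % n
  open _≈_

  ≈-isEquivalence : IsEquivalence _≈_
  ≈-isEquivalence = record
    { refl  = congruent refl
    ; sym   = λ (congruent p) → congruent (sym p)
    ; trans = λ (congruent p) (congruent q) → congruent (trans p q)
    }

  ≈-setoid : Setoid 0ℓ 0ℓ
  ≈-setoid = record { isEquivalence = ≈-isEquivalence }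

  open IsEquivalence ≈-isEquivalence public
    using () renaming (refl to ≈-refl; sym to ≈-sym; trans to ≈-trans; reflexive to ≈-reflexive)
  module ≈-Reasoning = Relation.Binary.Reasoning.Setoid ≈-setoid
  open ≈-Reasoning

  %-≈ : ∀ a → a % n ≈ a
  %-≈ a = congruent (m%n%n≡m%n a n)

  +-cong : ∀ {a b c d} → a ≈ b → c ≈ d → a + c ≈ b + d
  +-cong {a} {b} {c} {d} (congruent p) (congruent q) = congruent
    (trans (%-distribˡ-+ a c n) (trans (cong₂ (λ x y → (x + y) % n) p q) (sym (%-distribˡ-+ b d n))))

  n*≈0 : ∀ a → n * a ≈ 0
  n*≈0 a = congruent (trans (cong (_% n) (*-comm n a)) (m*n%n≡0 a n))

  +-cancelˡ-≈ : ∀ c {a b} → c + a ≈ c + b → a ≈ b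
  +-cancelˡ-≈ c {a} {b} c+a≈c+b = begin
    a              ≈⟨ +-cong c⁻+c≈0 ≈-refl ⟨
    c⁻ + c + a     ≡⟨ +-assoc c⁻ c a ⟩
    c⁻ + (c + a)   ≈⟨ +-cong (≈-refl {c⁻}) c+a≈c+b ⟩
    c⁻ + (c + b)   ≡⟨ +-assoc c⁻ c b ⟨
    c⁻ + c + b     ≈⟨ +-cong c⁻+c≈0 ≈-refl ⟩
    b              ∎
    where
    c⁻ = n ∸ c % n
    c⁻+c≈0 : c⁻ + c ≈ 0
    c⁻+c≈0 = begin
      c⁻ + c        ≈⟨ +-cong (≈-refl {c⁻}) (%-≈ c) ⟨
      c⁻ + c % n    ≡⟨ m∸n+n≡m (m%n≤n c n) ⟩
      n             ≈⟨ congruent (n%n≡0 n) ⟩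
      0             ∎

  +-cancel-≈ : ∀ {a b c d} → a ≈ b → a + c ≈ b + d → c ≈ d
  +-cancel-≈ {a} {b} {c} {d} a≈b a+c≈b+d = +-cancelˡ-≈ b (begin
    b + c   ≈⟨ +-cong a≈b (≈-refl {c}) ⟨
    a + c   ≈⟨ a+c≈b+d ⟩
    b + d   ∎)

  +-swap-≈0 : ∀ {a b c d} → a ≈ b + d → a + c ≈ b → c + d ≈ 0
  +-swap-≈0 {a} {b} {c} {d} a≈b+d a+c≈b = +-cancelˡ-≈ b (begin
    b + (c + d)   ≡⟨ cong (b +_) (+-comm c d) ⟩
    b + (d + c)   ≡⟨ +-assoc b d c ⟨
    b + d + c     ≈⟨ +-cong a≈b+d (≈-refl {c}) ⟨
    a + c         ≈⟨ a+c≈b ⟩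
    b             ≡⟨ +-identityʳ b ⟨
    b + 0         ∎)

  ≈⇒≡ : ∀ {a b} → a < n → b < n → a ≈ b → a ≡ b
  ≈⇒≡ a<n b<n (congruent p) = trans (sym (m<n⇒m%n≡m a<n)) (trans p (m<n⇒m%n≡m b<n))

  ∣∧<⇒≡0 : ∀ {a} → n ∣ a → a < n → a ≡ 0
  ∣∧<⇒≡0 {zero}  _   _   = refl
  ∣∧<⇒≡0 {suc a} n∣a a<n = contradiction n∣a (>⇒∤ a<n)

  *-cancelʳ-≈-≤ : Prime n → ∀ {a a' b} → a ≤ a' → a' < n → 0 < b → b < n → a * b ≈ a' * b → a ≡ a'
  *-cancelʳ-≈-≤ n-prime {a} {a'} {b} a≤a' a'<n 0<b b<n ab≈a'b =
    ≤-antisym a≤a' (m∸n≡0⇒m≤n (∣∧<⇒≡0 n∣d (≤-<-trans (m∸n≤m a' a) a'<n)))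
    where
    d = a' ∸ a
    db≈0 : d * b ≈ 0
    db≈0 = +-cancelˡ-≈ (a * b) (begin
      a * b + d * b   ≡⟨ *-distribʳ-+ b a d ⟨
      (a + d) * b     ≡⟨ cong (_* b) (m+[n∸m]≡n a≤a') ⟩
      a' * b          ≈⟨ ab≈a'b ⟨
      a * b           ≡⟨ +-identityʳ (a * b) ⟨
      a * b + 0       ∎)
    n∣d : n ∣ d
    n∣d with euclidsLemma d b n-prime (m%n≡0⇒n∣m (d * b) n (residues db≈0))
    ... | inj₁ n∣d = n∣d
    ... | inj₂ n∣b = contradiction (∣∧<⇒≡0 n∣b b<n) (≢-sym (<⇒≢ 0<b))

  *-cancelʳ-≈ : Prime n → ∀ {a a' b} → a < n → a' < n → 0 < b → b < n → a * b ≈ a' * b → a ≡ a'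
  *-cancelʳ-≈ n-prime {a} {a'} a<n a'<n 0<b b<n ab≈a'b with ≤-total a a'
  ... | inj₁ a≤a' = *-cancelʳ-≈-≤ n-prime a≤a' a'<n 0<b b<n ab≈a'b
  ... | inj₂ a'≤a = sym (*-cancelʳ-≈-≤ n-prime a'≤a a<n 0<b b<n (≈-sym ab≈a'b))

  double≉0 : Prime n → 2 < n → ∀ {a} → 0 < a → a < n → ¬ (2 * a ≈ 0)
  double≉0 n-prime 2<n 0<a a<n 2a≈0 with *-cancelʳ-≈ n-prime 2<n z<s 0<a a<n 2a≈0
  ... | ()

module Walk (n-1 : ℕ) where

  open Modulo n-1

  -- The edge leaving height β by the step e is a horizontal translate of the one leaving β' by e',
  -- traversed in the same or in the opposite direction.
  data Translates (β : ℕ) (e : ℕ × ℕ) (β' : ℕ) (e' : ℕ × ℕ) : Set where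
    forwards  : β ≈ β' → β + proj₂ e ≈ β' + proj₂ e' → proj₁ e ≈ proj₁ e' → Translates β e β' e'
    backwards : β ≈ β' + proj₂ e' → β + proj₂ e ≈ β' → proj₁ e + proj₁ e' ≈ 0 → Translates β e β' e'

  Translates-sym : ∀ {β e β' e'} → Translates β e β' e' → Translates β' e' β e
  Translates-sym (forwards b s c)  = forwards (≈-sym b) (≈-sym s) (≈-sym c)
  Translates-sym {e = e} {e' = e'} (backwards b s c) =
    backwards (≈-sym s) (≈-sym b) (≈-trans (≈-reflexive (+-comm (proj₁ e') (proj₁ e))) c)

  Translates⇒rise : ∀ {β e β' e'} → Translates β e β' e' →
    (β ≈ β' × proj₂ e ≈ proj₂ e') ⊎ proj₂ e + proj₂ e' ≈ 0
  Translates⇒rise (forwards b s _)  = inj₁ (b , +-cancel-≈ b s)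
  Translates⇒rise (backwards b s _) = inj₂ (+-swap-≈0 b s)

  Translates⇒level : ∀ {β a β' a'} → Translates β (a , 0) β' (a' , 0) →
    β ≈ β' × (a ≈ a' ⊎ a + a' ≈ 0)
  Translates⇒level (forwards b _ c)  = b , inj₁ c
  Translates⇒level {β' = β'} (backwards b _ c) = ≈-trans b (≈-reflexive (+-identityʳ β')) , inj₂ c

  height : List (ℕ × ℕ) → ℕ → ℕ
  height a i = sum (map proj₂ (take i a))

  step : List (ℕ × ℕ) → ℕ → ℕ × ℕ
  step a i = nth (0 , 0) a i

  cPow-%⇒≈ : ∀ t a c b d → cPow n t (a % n , c % n) ≡ (b % n , d % n) → a + t ≈ b × c ≈ d
  cPow-%⇒≈ t a c b d p =
    ≈-trans (≈-sym (+-cong (%-≈ a) (≈-refl {t}))) (congruent (cong proj₁ p)) , congruent (cong proj₂ p)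

  +-shift : ∀ x a t e → x + a + t + e ≡ x + (a + e) + t
  +-shift = solve-∀

  sameOrbit⇒Translates′ : ∀ x y {A B A' B'} e e' →
    SameOrbit n (((x + A) % n , (y + B) % n) , ((x + (A + proj₁ e)) % n , (y + (B + proj₂ e)) % n))
                (((x + A') % n , (y + B') % n) , ((x + (A' + proj₁ e')) % n , (y + (B' + proj₂ e')) % n)) →
    Translates B e B' e'
  sameOrbit⇒Translates′ x y {A} {B} {A'} {B'} (e₁ , e₂) (e₁' , e₂') (t , inj₁ (u≡u' , v≡v'))
    with cPow-%⇒≈ t (x + A) (y + B) (x + A') (y + B') u≡u'
       | cPow-%⇒≈ t (x + (A + e₁)) (y + (B + e₂)) (x + (A' + e₁')) (y + (B' + e₂')) v≡v'
  ... | x₁ , y₁ | x₂ , y₂ = forwards (+-cancelˡ-≈ y y₁) (+-cancelˡ-≈ y y₂)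
    (+-cancel-≈ x₁ (≈-trans (≈-reflexive (+-shift x A t e₁))
                   (≈-trans x₂ (≈-reflexive (sym (+-assoc x A' e₁'))))))
  sameOrbit⇒Translates′ x y {A} {B} {A'} {B'} (e₁ , e₂) (e₁' , e₂') (t , inj₂ (u≡v' , v≡u'))
    with cPow-%⇒≈ t (x + A) (y + B) (x + (A' + e₁')) (y + (B' + e₂')) u≡v'
       | cPow-%⇒≈ t (x + (A + e₁)) (y + (B + e₂)) (x + A') (y + B') v≡u'
  ... | x₁ , y₁ | x₂ , y₂ = backwards (+-cancelˡ-≈ y y₁) (+-cancelˡ-≈ y y₂)
    (+-swap-≈0 (≈-trans x₁ (≈-reflexive (sym (+-assoc x A' e₁'))))
               (≈-trans (≈-reflexive (+-shift x A t e₁)) x₂))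

  walkEdge-≡ : ∀ (x y : Fin n) a {i} → i < length a →
    walkEdge n (x , y) a i ≡
      ( ((toℕ x + sum (map proj₁ (take i a))) % n , (toℕ y + height a i) % n)
      , ((toℕ x + (sum (map proj₁ (take i a)) + proj₁ (step a i))) % n
        , (toℕ y + (height a i + proj₂ (step a i))) % n))
  walkEdge-≡ x y a {i} i<len =
    cong₂ (λ s₁ s₂ → (walkVertex n (x , y) a i , ((toℕ x + s₁) % n , (toℕ y + s₂) % n)))
          (sum-map-take-suc (0 , 0) proj₁ a i<len) (sum-map-take-suc (0 , 0) proj₂ a i<len)

  sameOrbit⇒Translates : ∀ (x y : Fin n) a {i j} → i < length a → j < length a →
    SameOrbit n (walkEdge n (x , y) a i) (walkEdge n (x , y) a j) →
    Translates (height a i) (step a i) (height a j) (step a j)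
  sameOrbit⇒Translates x y a {i} {j} i<len j<len orbit =
    sameOrbit⇒Translates′ (toℕ x) (toℕ y) (step a i) (step a j)
      (subst₂ (SameOrbit n) (walkEdge-≡ x y a i<len) (walkEdge-≡ x y a j<len) orbit)

module Staircase (n-1 : ℕ) where

  open Modulo n-1
  open Walk n-1

  N h : ℕ
  N = 2 * n
  h = n-1 / 2

  L : List (ℕ × ℕ)
  L = staircase n

  -- the step lengths 2k - 1 and 2k of the stretch S_k, k = q + 1
  δ δ⁺ : ℕ → ℕ
  δ  q = 2 * suc q ∸ 1
  δ⁺ q = 2 * suc q

  stretchEntry-rise : ∀ k m → stretchEntry n k (suc (m + m)) ≡ (0 , 2 * k ∸ 1)
  stretchEntry-rise k m rewrite [1+m+m]%2≡1 m = refl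

  stretchEntry-run : ∀ k m → suc m < n → stretchEntry n k (suc (suc (m + m))) ≡ (2 * k ∸ 1 , 0)
  stretchEntry-run k m 1+m<n
    rewrite [2+m+m]%2≡0 m
          | ≢⇒≡ᵇ≡false (λ eq → <⇒≢ 1+m<n (*-cancelˡ-≡ (suc m) n 2 (trans (2*suc≡ m) eq))) = refl

  stretchEntry-turn : ∀ k → stretchEntry n k (suc (suc (n-1 + n-1))) ≡ (2 * k , 0)
  stretchEntry-turn k rewrite [2+m+m]%2≡0 n-1 | ≡⇒≡ᵇ≡true (sym (2*suc≡ n-1)) = refl

  -- Position r (from 0) of the stretch S_(q+1) holds the step e, taken from height β.
  data Shape (q : ℕ) : ℕ → ℕ → ℕ × ℕ → Set where
    rise : ∀ {β} m → m < n → β ≈ m * δ q → Shape q (m + m) β (0 , δ q)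
    run  : ∀ {β} m → suc m < n → β ≈ suc m * δ q → Shape q (suc (m + m)) β (δ q , 0)
    turn : ∀ {β} → β ≈ 0 → Shape q (suc (n-1 + n-1)) β (δ⁺ q , 0)

  Shape-resp : ∀ {q r β β' e} → β ≈ β' → Shape q r β e → Shape q r β' e
  Shape-resp β≈β' (rise m m<n β≈) = rise m m<n (≈-trans (≈-sym β≈β') β≈)
  Shape-resp β≈β' (run m m<n β≈)  = run m m<n (≈-trans (≈-sym β≈β') β≈)
  Shape-resp β≈β' (turn β≈)       = turn (≈-trans (≈-sym β≈β') β≈)

  stretch-shape : ∀ q {r} → r < N → Shape q r (⌈ r /2⌉ * δ q) (stretchEntry n (suc q) (suc r))
  stretch-shape q {r} r<N with parity r
  ... | even m rewrite stretchEntry-rise (suc q) m =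
    rise m (*-cancelˡ-< 2 m n (subst (_< N) (sym (2*≡ m)) r<N))
           (≈-reflexive (cong (_* δ q) (sym (n≡⌈n+n/2⌉ m))))
  ... | odd m with m≤n⇒m<n∨m≡n (*-cancelˡ-≤ 2 (subst (_≤ N) (sym (2*suc≡ m)) r<N))
  ...   | inj₁ 1+m<n rewrite stretchEntry-run (suc q) m 1+m<n =
    run m 1+m<n (≈-reflexive (cong (λ k → suc k * δ q) (sym (n≡⌊n+n/2⌋ m))))
  ...   | inj₂ refl rewrite stretchEntry-turn (suc q) =
    turn (≈-trans (≈-reflexive (cong (λ k → suc k * δ q) (sym (n≡⌊n+n/2⌋ n-1)))) (n*≈0 (δ q)))

  Shape-next-height : ∀ {q r β e} → Shape q r β e → β + proj₂ e ≈ ⌈ suc r /2⌉ * δ q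
  Shape-next-height {q} (rise {β} m _ β≈) = begin
    β + δ q                  ≈⟨ +-cong β≈ (≈-refl {δ q}) ⟩
    m * δ q + δ q            ≡⟨ +-comm (m * δ q) (δ q) ⟩
    suc m * δ q              ≡⟨ cong (λ k → suc k * δ q) (n≡⌊n+n/2⌋ m) ⟩
    ⌈ suc (m + m) /2⌉ * δ q  ∎
    where open ≈-Reasoning
  Shape-next-height {q} (run {β} m _ β≈) = begin
    β + 0                          ≡⟨ +-identityʳ β ⟩
    β                              ≈⟨ β≈ ⟩
    suc m * δ q                    ≡⟨ cong (λ k → suc k * δ q) (n≡⌈n+n/2⌉ m) ⟩
    ⌈ suc (suc (m + m)) /2⌉ * δ q  ∎
    where open ≈-Reasoning
  Shape-next-height {q} (turn {β} β≈0) = begin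
    β + 0                                  ≡⟨ +-identityʳ β ⟩
    β                                      ≈⟨ β≈0 ⟩
    0                                      ≈⟨ n*≈0 (δ q) ⟨
    n * δ q                                ≡⟨ cong (λ k → suc k * δ q) (n≡⌈n+n/2⌉ n-1) ⟩
    ⌈ suc (suc (n-1 + n-1)) /2⌉ * δ q      ∎
    where open ≈-Reasoning

  stretch-length : ∀ k → length (stretch n k) ≡ N
  stretch-length k = trans (length-map (stretchEntry n k) (applyUpTo suc N)) (length-applyUpTo suc N)

  staircase-length : length L ≡ h * N
  staircase-length = length-concatMap-applyUpTo (stretch n) stretch-length suc h

  staircase-step : ∀ {q r} → q < h → r < N → step L (q * N + r) ≡ stretchEntry n (suc q) (suc r)
  staircase-step {q} q<h r<N =
    trans (nth-concatMap-applyUpTo (stretch n) stretch-length (0 , 0) suc q<h r<N)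
          (nth-map-applyUpTo (0 , 0) (stretchEntry n (suc q)) suc N r<N)

  index< : ∀ {q r} → q < h → r < N → q * N + r < length L
  index< {q} {r} q<h r<N = subst (q * N + r <_) (sym staircase-length)
    (<-≤-trans (+-monoʳ-< (q * N) r<N) (subst (_≤ h * N) (+-comm N (q * N)) (*-monoˡ-≤ N q<h)))

  staircase-height : ∀ {q r} → q < h → r ≤ N → height L (q * N + r) ≈ ⌈ r /2⌉ * δ q
  staircase-height {zero}  {zero}  _ _ = ≈-refl
  staircase-height {suc q} {zero}  1+q<h _ = begin
    height L (suc q * N + 0)  ≡⟨ cong (height L) (trans (+-identityʳ _) (+-comm N (q * N))) ⟩
    height L (q * N + N)      ≈⟨ staircase-height (<-trans (n<1+n q) 1+q<h) ≤-refl ⟩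
    ⌈ N /2⌉ * δ q             ≡⟨ cong (λ k → ⌈ k /2⌉ * δ q) (2*≡ n) ⟩
    ⌈ n + n /2⌉ * δ q         ≡⟨ cong (_* δ q) (n≡⌈n+n/2⌉ n) ⟨
    n * δ q                   ≈⟨ n*≈0 (δ q) ⟩
    0                         ∎
    where open ≈-Reasoning
  staircase-height {q} {suc r} q<h r<N = begin
    height L (q * N + suc r)                      ≡⟨ cong (height L) (+-suc (q * N) r) ⟩
    height L (suc (q * N + r))                    ≡⟨ sum-map-take-suc (0 , 0) proj₂ L (index< q<h r<N) ⟩
    height L (q * N + r) + proj₂ (step L (q * N + r))
      ≈⟨ +-cong (staircase-height q<h (<⇒≤ r<N)) (≈-reflexive (cong proj₂ (staircase-step q<h r<N))) ⟩
    ⌈ r /2⌉ * δ q + proj₂ (stretchEntry n (suc q) (suc r))  ≈⟨ Shape-next-height (stretch-shape q r<N) ⟩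
    ⌈ suc r /2⌉ * δ q                             ∎
    where open ≈-Reasoning

  1+q+1+q'<n : ∀ {q q'} → q < h → q' < h → suc q + suc q' < n
  1+q+1+q'<n q<h q'<h = s≤s (≤-trans (+-mono-≤ q<h q'<h) h+h≤n-1)
    where
    h+h≤n-1 : h + h ≤ n-1
    h+h≤n-1 = subst (_≤ n-1) (trans (*-comm h 2) (2*≡ h)) (m/n*n≤m n-1 2)

  δ≡ : ∀ q → δ q ≡ suc (q + q)
  δ≡ q = cong pred (2*suc≡ q)

  0<δ : ∀ q → 0 < δ q
  0<δ q = subst (0 <_) (sym (δ≡ q)) z<s

  δ⁺<n : ∀ {q} → q < h → δ⁺ q < n
  δ⁺<n {q} q<h = subst (_< n) (sym (2*≡ (suc q))) (1+q+1+q'<n q<h q<h)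

  δ<n : ∀ {q} → q < h → δ q < n
  δ<n {q} q<h = ≤-<-trans (m∸n≤m (δ⁺ q) 1) (δ⁺<n q<h)

  2<n : ∀ {q} → q < h → 2 < n
  2<n q<h = ≤-<-trans (*-monoʳ-≤ 2 (s≤s z≤n)) (δ⁺<n q<h)

  δ≉0 : ∀ {q} → q < h → ¬ δ q ≈ 0
  δ≉0 {q} q<h δ≈0 = <⇒≢ (0<δ q) (sym (≈⇒≡ (δ<n q<h) z<s δ≈0))

  δ⁺-injective : ∀ {q q'} → q < h → q' < h → δ⁺ q ≈ δ⁺ q' → q ≡ q'
  δ⁺-injective {q} {q'} q<h q'<h δ⁺≈δ⁺ =
    suc-injective (*-cancelˡ-≡ (suc q) (suc q') 2 (≈⇒≡ (δ⁺<n q<h) (δ⁺<n q'<h) δ⁺≈δ⁺))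

  δ-injective : ∀ {q q'} → q < h → q' < h → δ q ≈ δ q' → q ≡ q'
  δ-injective {q} {q'} q<h q'<h δ≈δ =
    suc-injective (*-cancelˡ-≡ (suc q) (suc q') 2 (cong suc (≈⇒≡ (δ<n q<h) (δ<n q'<h) δ≈δ)))

  δ-multiple-injective : Prime n → ∀ {q a a'} → q < h → a < n → a' < n → a * δ q ≈ a' * δ q → a ≡ a'
  δ-multiple-injective n-prime {q} q<h a<n a'<n = *-cancelʳ-≈ n-prime a<n a'<n (0<δ q) (δ<n q<h)

  δ+δ≉0 : Prime n → ∀ {q q'} → q < h → q' < h → ¬ δ q + δ q' ≈ 0
  δ+δ≉0 n-prime {q} {q'} q<h q'<h sum≈0 =
    double≉0 n-prime (2<n q<h) z<s (≤-<-trans (s≤s (+-monoʳ-≤ q (n≤1+n q'))) (1+q+1+q'<n q<h q'<h))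
      (≈-trans (≈-reflexive (sym (trans (cong₂ _+_ (δ≡ q) (δ≡ q')) (sum-of-odds q q')))) sum≈0)
    where
    sum-of-odds : ∀ a b → suc (a + a) + suc (b + b) ≡ 2 * suc (a + b)
    sum-of-odds = solve-∀

  δ⁺+δ⁺≉0 : Prime n → ∀ {q q'} → q < h → q' < h → ¬ δ⁺ q + δ⁺ q' ≈ 0
  δ⁺+δ⁺≉0 n-prime {q} {q'} q<h q'<h sum≈0 =
    double≉0 n-prime (2<n q<h) z<s (1+q+1+q'<n q<h q'<h)
      (≈-trans (≈-reflexive (*-distribˡ-+ 2 (suc q) (suc q'))) sum≈0)

  ¬Translates-rise-level : ∀ {q β β' a} → q < h → ¬ Translates β (0 , δ q) β' (a , 0)
  ¬Translates-rise-level {q} q<h t with Translates⇒rise t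
  ... | inj₁ (_ , δ≈0) = δ≉0 q<h δ≈0
  ... | inj₂ δ+0≈0     = δ≉0 q<h (≈-trans (≈-reflexive (sym (+-identityʳ (δ q)))) δ+0≈0)

  ¬Translates-run-turn : Prime n → ∀ {q m β β' a} → q < h → suc m < n → β ≈ suc m * δ q → β' ≈ 0 →
    ¬ Translates β (δ q , 0) β' (a , 0)
  ¬Translates-run-turn n-prime q<h 1+m<n β≈ β'≈0 t
    with δ-multiple-injective n-prime q<h 1+m<n z<s
           (≈-trans (≈-sym β≈) (≈-trans (proj₁ (Translates⇒level t)) β'≈0))
  ... | ()

  shape-injective : Prime n → ∀ {q q' r r' β β' e e'} → q < h → q' < h →
    Shape q r β e → Shape q' r' β' e' → Translates β e β' e' → q ≡ q' × r ≡ r'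
  shape-injective n-prime q<h q'<h (rise m m<n β≈) (rise m' m'<n β'≈) t with Translates⇒rise t
  ... | inj₂ δ+δ≈0 = ⊥-elim (δ+δ≉0 n-prime q<h q'<h δ+δ≈0)
  ... | inj₁ (β≈β' , δ≈δ) with δ-injective q<h q'<h δ≈δ
  ...   | refl = refl , cong (λ k → k + k)
                   (δ-multiple-injective n-prime q<h m<n m'<n (≈-trans (≈-sym β≈) (≈-trans β≈β' β'≈)))
  shape-injective n-prime q<h q'<h (rise _ _ _) (run _ _ _) t = ⊥-elim (¬Translates-rise-level q<h t)
  shape-injective n-prime q<h q'<h (rise _ _ _) (turn _)    t = ⊥-elim (¬Translates-rise-level q<h t)
  shape-injective n-prime q<h q'<h (run _ _ _) (rise _ _ _) t =
    ⊥-elim (¬Translates-rise-level q'<h (Translates-sym t))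
  shape-injective n-prime q<h q'<h (turn _)    (rise _ _ _) t =
    ⊥-elim (¬Translates-rise-level q'<h (Translates-sym t))
  shape-injective n-prime q<h q'<h (run m m<n β≈) (run m' m'<n β'≈) t with Translates⇒level t
  ... | _ , inj₂ δ+δ≈0 = ⊥-elim (δ+δ≉0 n-prime q<h q'<h δ+δ≈0)
  ... | β≈β' , inj₁ δ≈δ with δ-injective q<h q'<h δ≈δ
  ...   | refl = refl , cong (λ k → suc (k + k)) (suc-injective
                   (δ-multiple-injective n-prime q<h m<n m'<n (≈-trans (≈-sym β≈) (≈-trans β≈β' β'≈))))
  shape-injective n-prime q<h q'<h (run _ m<n β≈) (turn β'≈0) t =
    ⊥-elim (¬Translates-run-turn n-prime q<h m<n β≈ β'≈0 t)
  shape-injective n-prime q<h q'<h (turn β≈0) (run _ m'<n β'≈) t =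
    ⊥-elim (¬Translates-run-turn n-prime q'<h m'<n β'≈ β≈0 (Translates-sym t))
  shape-injective n-prime q<h q'<h (turn _) (turn _) t with Translates⇒level t
  ... | _ , inj₂ δ⁺+δ⁺≈0 = ⊥-elim (δ⁺+δ⁺≉0 n-prime q<h q'<h δ⁺+δ⁺≈0)
  ... | _ , inj₁ δ⁺≈δ⁺ with δ⁺-injective q<h q'<h δ⁺≈δ⁺
  ...   | refl = refl , refl

  quotient<h : ∀ {i} → i < length L → i / N < h
  quotient<h i<len = m<n*o⇒m/o<n (subst (_ <_) staircase-length i<len)

  staircase-shape : ∀ {i} → i < length L → Shape (i / N) (i % N) (height L i) (step L i)
  staircase-shape {i} i<len =
    subst (λ k → Shape q r (height L k) (step L k)) i≡qN+r
      (Shape-resp (≈-sym (staircase-height q<h (<⇒≤ r<N)))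
        (subst (Shape q r _) (sym (staircase-step q<h r<N)) (stretch-shape q r<N)))
    where
    q = i / N
    r = i % N
    q<h = quotient<h i<len
    r<N = m%n<n i N
    i≡qN+r : q * N + r ≡ i
    i≡qN+r = trans (+-comm (q * N) r) (sym (m≡m%n+[m/n]*n i N))

  staircase-index-injective : Prime n → ∀ {i j} → i < length L → j < length L →
    Translates (height L i) (step L i) (height L j) (step L j) → i ≡ j
  staircase-index-injective n-prime {i} {j} i<len j<len t
    with shape-injective n-prime (quotient<h i<len) (quotient<h j<len)
           (staircase-shape i<len) (staircase-shape j<len) t
  ... | q≡q' , r≡r' = begin
    i                  ≡⟨ m≡m%n+[m/n]*n i N ⟩
    i % N + i / N * N  ≡⟨ cong₂ (λ r q → r + q * N) r≡r' q≡q' ⟩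
    j % N + j / N * N  ≡⟨ m≡m%n+[m/n]*n j N ⟨
    j                  ∎
    where open ≡-Reasoning

-- The oddness of n is needed only to rule out n = 0: a prime n with a nonempty staircase is at least 3.
proposition14 : (n : ℕ) → Prime n → n % 2 ≡ 1 → (v0 : Fin n × Fin n) →
    (i j : ℕ) → i < length (staircase n) → j < length (staircase n) →
    SameOrbit n (walkEdge n v0 (staircase n) i) (walkEdge n v0 (staircase n) j) →
    i ≡ j
proposition14 zero      _       ()  _       _ _ _     _     _
proposition14 (suc n-1) n-prime _   (x , y) i j i<len j<len orbit =
  staircase-index-injective n-prime i<len j<len (sameOrbit⇒Translates x y L i<len j<len orbit)
  where open Staircase n-1
        open Walk n-1
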